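{- Let $A$ and $t$ be positive integers with $|R_A|\le2^t$, and let $y_t=1-2^{ -t}$. Then $f_A''(y)\ll A^2|R_A|$ for $y\in(y_t,1)$, with an absolute implied constant.
   Context: $R_A=\{a^2:a\in\mathbb{Z}_A\}$, written as $\{0=i_1<\dots<i_r\}\subseteq\{0,\dots,A-1\}$, $r=|R_A|$; $s_j=i_{j+1}-i_j$ ($j<r$), $s_r=A-i_r$, indices modulo $r$. $f_A(y)=F(y)/Q(y)$ with $Q(y)=1+y+\dots+y^{r-1}$ and $F(y)=\sum_{k=0}^r\beta_ky^k$, $\beta_0=\beta_r=\sum_{i=1}^rs_i^2$, $\beta_k=2\sum_{i=1}^rs_is_{i+k}$ for $0<k<r$.
   Formalization: The point y in the bound on $f_A''(y)$ ranges only over the rational points of $(y_t,1)$. -}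

module Defs where

open import Data.Nat as ℕ using (ℕ; zero; suc; _∸_; _%_)
open import Data.Integer as ℤ using (+_; -[1+_])
open import Data.Rational as ℚ using (ℚ; 0ℚ; 1ℚ; _/_; _+_; _*_; _-_; _÷_; ≢-nonZero)
open import Data.Rational.Properties using (_≟_)
open import Data.List using (List; []; _∷_; foldr; filter; upTo; length; map; replicate)
open import Data.Nat.ListAction using (sum)
open import Data.List.Relation.Unary.Any using (any?)
open import Data.Product using (_×_; _,_)
open import Data.Bool using (if_then_else_; _∨_)
open import Relation.Nullary using (yes; no)
open import Relation.Nullary.Decidable using (⌊_⌋)

ℕtoℚ : ℕ → ℚ
ℕtoℚ n = + n / 1

-- Polynomials over ℚ as coefficient lists (constant term first)

Poly : Set
Poly = List ℚ

scale : ℚ → Poly → Poly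
scale c = map (c *_)

_⊕_ : Poly → Poly → Poly
[]       ⊕ q        = q
(a ∷ p)  ⊕ []       = a ∷ p
(a ∷ p)  ⊕ (b ∷ q)  = (a + b) ∷ (p ⊕ q)

_⊗_ : Poly → Poly → Poly
[]      ⊗ q = []
(a ∷ p) ⊗ q = scale a q ⊕ (0ℚ ∷ (p ⊗ q))

⊖_ : Poly → Poly
⊖ p = scale (ℤ.-[1+ 0 ] / 1) p

derivFrom : ℕ → Poly → Poly
derivFrom k []       = []
derivFrom k (b ∷ bs) = (ℕtoℚ k * b) ∷ derivFrom (suc k) bs

deriv : Poly → Poly
deriv []      = []
deriv (a ∷ p) = derivFrom 1 p

eval : Poly → ℚ → ℚ
eval p y = foldr (λ a acc → a + y * acc) 0ℚ p

RatFun : Set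
RatFun = Poly × Poly

rderiv : RatFun → RatFun
rderiv (N , D) = ((deriv N ⊗ D) ⊕ (⊖ (N ⊗ deriv D))) , (D ⊗ D)

-- division, returning 0 when the denominator vanishes (never used there:
-- the denominators below are powers of Q, positive for y > 0)
divℚ : ℚ → ℚ → ℚ
divℚ p q with q ≟ 0ℚ
... | yes _  = 0ℚ
... | no q≢0 = _÷_ p q {{≢-nonZero q≢0}}

value : RatFun → ℚ → ℚ
value (N , D) y = divℚ (eval N y) (eval D y)

-- R_A = { a^2 : a ∈ ℤ_A } ⊆ {0,…,A-1}, listed increasingly

R : ℕ → List ℕ
R zero    = []
R (suc n) = filter (λ i → any? (λ a → (a ℕ.* a) % suc n ℕ.≟ i) (upTo (suc n))) (upTo (suc n))

r : ℕ → ℕ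
r A = length (R A)

gaps : ℕ → List ℕ → List ℕ
gaps A []             = []
gaps A (x ∷ [])       = (A ∸ x) ∷ []
gaps A (x ∷ y ∷ rest) = (y ∸ x) ∷ gaps A (y ∷ rest)

nth : List ℕ → ℕ → ℕ
nth []       _       = 0
nth (x ∷ xs) zero    = x
nth (x ∷ xs) (suc j) = nth xs j

modr : ℕ → ℕ → ℕ
modr j zero    = j
modr j (suc n) = j % suc n

-- s j = s_{j+1} in the paper's 1-based indexing, indices taken modulo r
s : ℕ → ℕ → ℕ
s A j = nth (gaps A (R A)) (modr j (r A))

β : ℕ → ℕ → ℕ
β A k = if ⌊ k ℕ.≟ 0 ⌋ ∨ ⌊ k ℕ.≟ r A ⌋
          then sum (map (λ i → s A i ℕ.* s A i) (upTo (r A)))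
          else 2 ℕ.* sum (map (λ i → s A i ℕ.* s A (i ℕ.+ k)) (upTo (r A)))

Fpoly : ℕ → Poly
Fpoly A = map (λ k → ℕtoℚ (β A k)) (upTo (suc (r A)))

Qpoly : ℕ → Poly
Qpoly A = replicate (r A) 1ℚ

fA : ℕ → RatFun
fA A = Fpoly A , Qpoly A

fA'' : ℕ → ℚ → ℚ
fA'' A = value (rderiv (rderiv (fA A)))

½ : ℚ
½ = + 1 / 2

powℚ : ℚ → ℕ → ℚ
powℚ q zero    = 1ℚ
powℚ q (suc n) = q * powℚ q n

yt : ℕ → ℚ
yt t = 1ℚ - powℚ ½ t

{-# OPTIONS --safe #-}
module Submission where

-- f_A'' = (F''Q³ - 2F'Q'Q² - FQ''Q² + 2FQ'²Q) / Q⁴, and F and Q have nonnegative coefficients.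
-- On [0,1] such a polynomial of degree at most r is bounded by its coefficient sum, and each
-- differentiation multiplies that sum by at most r; so F, F', F'' are at most G, rG, r²G with
-- G = F(1) = Σ β_k, and Q', Q'' are at most r², r³.  The gaps s_i are r-periodic with Σ s_i ≤ A,
-- so any r + 1 consecutive gaps sum to at most 2A, whence G ≤ 4A².  For y > y_t we have
-- (1 - y) r ≤ 2^(-t) r ≤ 1, and Bernoulli's inequality y^k ≥ 1 - k (1 - y) gives Q(y) ≥ r/2.
-- Each of the four terms of f_A'' is then O(r G) = O(A² r).

open import Defs

module Combinatorics where
  open import Data.Nat
  open import Data.Nat.Properties
  open import Data.Nat.DivMod using ([m+n]%n≡m%n; m<n⇒m%n≡m)
  import Data.Nat.ListAction as List
  open import Data.Nat.Tactic.RingSolver using (solve-∀)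
  open import Data.Fin as Fin using (toℕ; inject₁; fromℕ)
  open import Data.Fin.Properties using (toℕ<n; toℕ-inject₁; toℕ-fromℕ)
  open import Data.Vec.Functional using (Vector)
  open import Algebra.Properties.Semiring.Sum +-*-semiring
    using (sum; sum-syntax; sum-cong-≗; sum-init-last; ∑-comm; *-distribˡ-sum; *-distribʳ-sum)
  open import Data.List using ([]; _∷_; map; upTo; applyUpTo; length)
  open import Data.List.Relation.Unary.All using (All; []; _∷_)
  import Data.List.Relation.Unary.All.Properties as All
  open import Data.List.Relation.Unary.Linked using (Linked; []; _∷_)
  import Data.List.Relation.Unary.Linked.Properties as Linked
  open import Data.List.Relation.Unary.Any using (any?)
  open import Function using (id; _∘_)
  open import Relation.Nullary using (yes; no)
  open import Relation.Binary.PropositionalEquality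

  sum-map-applyUpTo : ∀ (f g : ℕ → ℕ) n → List.sum (map f (applyUpTo g n)) ≡ ∑[ i < n ] f (g (toℕ i))
  sum-map-applyUpTo f g zero    = refl
  sum-map-applyUpTo f g (suc n) = cong (f (g 0) +_) (sum-map-applyUpTo f (g ∘ suc) n)

  sum-map-upTo : ∀ (f : ℕ → ℕ) n → List.sum (map f (upTo n)) ≡ ∑[ i < n ] f (toℕ i)
  sum-map-upTo f = sum-map-applyUpTo f id

  sum-mono-≤ : ∀ {n} {f g : Vector ℕ n} → (∀ i → f i ≤ g i) → sum f ≤ sum g
  sum-mono-≤ {zero}  f≤g = z≤n
  sum-mono-≤ {suc n} f≤g = +-mono-≤ (f≤g _) (sum-mono-≤ (f≤g ∘ Fin.suc))

  ∑-nth : ∀ l → ∑[ i < length l ] nth l (toℕ i) ≡ List.sum l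
  ∑-nth []      = refl
  ∑-nth (x ∷ l) = cong (x +_) (∑-nth l)

  ∑-periodic-window : ∀ (h : ℕ → ℕ) m → (∀ j → h (j + m) ≡ h j) →
                      ∀ i → ∑[ k < m ] h (i + toℕ k) ≡ ∑[ k < m ] h (toℕ k)
  ∑-periodic-window h zero    per i       = refl
  ∑-periodic-window h (suc m) per zero    = refl
  ∑-periodic-window h (suc m) per (suc i) = trans shift (∑-periodic-window h (suc m) per i)
    where
    open ≡-Reasoning
    shift : ∑[ k < suc m ] h (suc i + toℕ k) ≡ ∑[ k < suc m ] h (i + toℕ k)
    shift = begin
      ∑[ k < suc m ] h (suc i + toℕ k)
        ≡⟨ sum-init-last {m} (λ k → h (suc i + toℕ k)) ⟩
      ∑[ k < m ] h (suc i + toℕ (inject₁ k)) + h (suc i + toℕ (fromℕ m))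
        ≡⟨ cong₂ _+_ (sum-cong-≗ {m} λ k → cong (λ j → h (suc i + j)) (toℕ-inject₁ k))
                     (trans (cong (λ j → h (suc i + j)) (toℕ-fromℕ m)) (trans (cong h (sym (+-suc i m))) (per i))) ⟩
      ∑[ k < m ] h (suc i + toℕ k) + h i
        ≡⟨ +-comm _ (h i) ⟩
      h i + ∑[ k < m ] h (suc i + toℕ k)
        ≡⟨ cong₂ _+_ (cong h (sym (+-identityʳ i))) (sum-cong-≗ {m} λ k → cong h (sym (+-suc i (toℕ k)))) ⟩
      ∑[ k < suc m ] h (i + toℕ k) ∎

  sum-gaps : ∀ A x L → Linked _≤_ (x ∷ L) → All (_≤ A) (x ∷ L) → List.sum (gaps A (x ∷ L)) ≡ A ∸ x
  sum-gaps A x []      _           _                = +-identityʳ (A ∸ x)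
  sum-gaps A x (y ∷ L) (x≤y ∷ sorted) (_ ∷ y≤A ∷ bounded) = begin
    (y ∸ x) + List.sum (gaps A (y ∷ L)) ≡⟨ cong ((y ∸ x) +_) (sum-gaps A y L sorted (y≤A ∷ bounded)) ⟩
    (y ∸ x) + (A ∸ y)                    ≡⟨ +-comm (y ∸ x) (A ∸ y) ⟩
    (A ∸ y) + (y ∸ x)                    ≡⟨ +-∸-assoc (A ∸ y) x≤y ⟨
    (A ∸ y) + y ∸ x                      ≡⟨ cong (_∸ x) (m∸n+n≡m y≤A) ⟩
    A ∸ x                                ∎
    where open ≡-Reasoning

  sum-gaps-≤ : ∀ A L → Linked _≤_ L → All (_≤ A) L → List.sum (gaps A L) ≤ A
  sum-gaps-≤ A []      _      _       = z≤n
  sum-gaps-≤ A (x ∷ L) sorted bounded = ≤-trans (≤-reflexive (sum-gaps A x L sorted bounded)) (m∸n≤m A x)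

  gaps-≤ : ∀ A L → All (_≤ A) L → All (_≤ A) (gaps A L)
  gaps-≤ A []          _                   = []
  gaps-≤ A (x ∷ [])    _                   = m∸n≤m A x ∷ []
  gaps-≤ A (x ∷ y ∷ L) (_ ∷ y≤A ∷ bounded) = ≤-trans (m∸n≤m y x) y≤A ∷ gaps-≤ A (y ∷ L) (y≤A ∷ bounded)

  length-gaps : ∀ A L → length (gaps A L) ≡ length L
  length-gaps A []          = refl
  length-gaps A (x ∷ [])    = refl
  length-gaps A (x ∷ y ∷ L) = cong suc (length-gaps A (y ∷ L))

  nth-≤ : ∀ {A} L j → All (_≤ A) L → nth L j ≤ A
  nth-≤ []      j       _           = z≤n
  nth-≤ (x ∷ L) zero    (x≤A ∷ _)   = x≤A
  nth-≤ (x ∷ L) (suc j) (_ ∷ L≤A)   = nth-≤ L j L≤A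

  modr-< : ∀ {j m} → j < m → modr j m ≡ j
  modr-< {m = suc m} j<m = m<n⇒m%n≡m j<m

  R-sorted : ∀ A → Linked _≤_ (R A)
  R-sorted zero    = []
  R-sorted (suc n) = Linked.filter⁺ (λ i → any? (λ a → (a * a) % suc n ≟ i) (upTo (suc n))) ≤-trans
    (Linked.applyUpTo⁺₂ id (suc n) n≤1+n)

  R-≤ : ∀ A → All (_≤ A) (R A)
  R-≤ zero    = []
  R-≤ (suc n) = All.filter⁺ (λ i → any? (λ a → (a * a) % suc n ≟ i) (upTo (suc n)))
    (All.applyUpTo⁺₁ id (suc n) <⇒≤)

  s-periodic : ∀ A j → s A (j + r A) ≡ s A j
  s-periodic A j with r A
  ... | zero  = cong (nth (gaps A (R A))) (+-identityʳ j)
  ... | suc m = cong (nth (gaps A (R A))) ([m+n]%n≡m%n j (suc m))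

  s-≤ : ∀ A j → s A j ≤ A
  s-≤ A j = nth-≤ (gaps A (R A)) (modr j (r A)) (gaps-≤ A (R A) (R-≤ A))

  ∑s≤A : ∀ A → ∑[ i < r A ] s A (toℕ i) ≤ A
  ∑s≤A A = begin
    ∑[ i < r A ] s A (toℕ i)                ≡⟨ sum-cong-≗ {r A} (λ i → cong (nth G) (modr-< (toℕ<n i))) ⟩
    ∑[ i < length (R A) ] nth G (toℕ i)     ≡⟨ cong (λ n → ∑[ i < n ] nth G (toℕ i)) (length-gaps A (R A)) ⟨
    ∑[ i < length G ] nth G (toℕ i)         ≡⟨ ∑-nth G ⟩
    List.sum G                              ≤⟨ sum-gaps-≤ A (R A) (R-sorted A) (R-≤ A) ⟩
    A                                       ∎
    where
    open ≤-Reasoning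
    G = gaps A (R A)

  ∑-window-s≤A+A : ∀ A i → ∑[ k < suc (r A) ] s A (i + toℕ k) ≤ A + A
  ∑-window-s≤A+A A i = begin
    s A (i + 0) + ∑[ k < r A ] s A (i + suc (toℕ k))
      ≡⟨ cong (s A (i + 0) +_) (sum-cong-≗ {r A} λ k → cong (s A) (+-suc i (toℕ k))) ⟩
    s A (i + 0) + ∑[ k < r A ] s A (suc i + toℕ k)
      ≡⟨ cong (s A (i + 0) +_) (∑-periodic-window (s A) (r A) (s-periodic A) (suc i)) ⟩
    s A (i + 0) + ∑[ k < r A ] s A (toℕ k)
      ≤⟨ +-mono-≤ (s-≤ A (i + 0)) (∑s≤A A) ⟩
    A + A ∎
    where open ≤-Reasoning

  gapCorrelation : ℕ → ℕ → ℕ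
  gapCorrelation A k = ∑[ i < r A ] (s A (toℕ i) * s A (toℕ i + k))

  sum-squares-≤-gapCorrelation : ∀ A k → (∀ i → s A (i + k) ≡ s A i) →
                                 List.sum (map (λ i → s A i * s A i) (upTo (r A))) ≤ 2 * gapCorrelation A k
  sum-squares-≤-gapCorrelation A k s-shift = begin
    List.sum (map (λ i → s A i * s A i) (upTo (r A)))
      ≡⟨ sum-map-upTo (λ i → s A i * s A i) (r A) ⟩
    ∑[ i < r A ] (s A (toℕ i) * s A (toℕ i))
      ≡⟨ sum-cong-≗ {r A} (λ i → cong (s A (toℕ i) *_) (s-shift (toℕ i))) ⟨
    gapCorrelation A k
      ≤⟨ m≤m+n _ _ ⟩
    2 * gapCorrelation A k ∎
    where open ≤-Reasoning

  β-≤ : ∀ A k → β A k ≤ 2 * gapCorrelation A k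
  β-≤ A k with k ≟ 0
  ... | yes refl = sum-squares-≤-gapCorrelation A 0 (λ i → cong (s A) (+-identityʳ i))
  ... | no _ with k ≟ r A
  ...   | yes refl = sum-squares-≤-gapCorrelation A (r A) (s-periodic A)
  ...   | no _     = ≤-reflexive (cong (2 *_) (sum-map-upTo (λ i → s A i * s A (i + k)) (r A)))

  sum-β-≤ : ∀ A → List.sum (map (β A) (upTo (suc (r A)))) ≤ 4 * (A * A)
  sum-β-≤ A = begin
    List.sum (map (β A) (upTo (suc (r A))))
      ≡⟨ sum-map-upTo (β A) (suc (r A)) ⟩
    ∑[ k < suc (r A) ] β A (toℕ k)
      ≤⟨ sum-mono-≤ {suc (r A)} (λ k → β-≤ A (toℕ k)) ⟩
    ∑[ k < suc (r A) ] (2 * gapCorrelation A (toℕ k))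
      ≡⟨ *-distribˡ-sum {suc (r A)} 2 (λ k → gapCorrelation A (toℕ k)) ⟨
    2 * ∑[ k < suc (r A) ] ∑[ i < r A ] (s A (toℕ i) * s A (toℕ i + toℕ k))
      ≡⟨ cong (2 *_) (∑-comm {suc (r A)} {r A} (λ k i → s A (toℕ i) * s A (toℕ i + toℕ k))) ⟩
    2 * ∑[ i < r A ] ∑[ k < suc (r A) ] (s A (toℕ i) * s A (toℕ i + toℕ k))
      ≡⟨ cong (2 *_) (sum-cong-≗ {r A} λ i → *-distribˡ-sum {suc (r A)} (s A (toℕ i)) (λ k → s A (toℕ i + toℕ k))) ⟨
    2 * ∑[ i < r A ] (s A (toℕ i) * ∑[ k < suc (r A) ] s A (toℕ i + toℕ k))
      ≤⟨ *-monoʳ-≤ 2 (sum-mono-≤ {r A} λ i → *-monoʳ-≤ (s A (toℕ i)) (∑-window-s≤A+A A (toℕ i))) ⟩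
    2 * ∑[ i < r A ] (s A (toℕ i) * (A + A))
      ≡⟨ cong (2 *_) (*-distribʳ-sum {r A} (A + A) (λ i → s A (toℕ i))) ⟨
    2 * ((∑[ i < r A ] s A (toℕ i)) * (A + A))
      ≤⟨ *-monoʳ-≤ 2 (*-monoˡ-≤ (A + A) (∑s≤A A)) ⟩
    2 * (A * (A + A))
      ≡⟨ twice-a[a+a] A ⟩
    4 * (A * A) ∎
    where
    open ≤-Reasoning
    twice-a[a+a] : ∀ a → 2 * (a * (a + a)) ≡ 4 * (a * a)
    twice-a[a+a] = solve-∀

module Estimates where
  open import Data.Nat as ℕ using (ℕ; zero; suc; _^_)
  import Data.Nat.Properties as ℕ
  import Data.Nat.Tactic.RingSolver as ℕ
  open import Data.Nat.Coprimality as Coprime using (1-coprimeTo)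
  import Data.Integer as ℤ
  import Data.Integer.Properties as ℤ
  open import Data.Rational hiding (½)
  open import Data.Rational.Properties
  open import Data.List using ([]; _∷_; foldr; length; map; replicate; upTo)
  open import Data.List.Relation.Unary.All using (All; []; _∷_)
  open import Data.List.Relation.Unary.All.Properties using (replicate⁺)
  open import Data.List.Properties using (length-map; length-upTo; length-replicate)
  import Data.Nat.ListAction as List
  open import Data.Product using (_,_; proj₁)
  open import Relation.Nullary.Decidable using (dec⇒maybe)
  open import Relation.Binary.PropositionalEquality
  open import Relation.Nullary using (yes; no)
  open import Tactic.RingSolver using (solve-∀)
  import Tactic.RingSolver.Core.AlmostCommutativeRing as ACR

  -- The solver cannot treat a free variable such as the point y as a constant, so every ring
  -- identity below is stated for all of its variables.
  ℚ-ring : ACR.AlmostCommutativeRing _ _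
  ℚ-ring = ACR.fromCommutativeRing +-*-commutativeRing (λ x → dec⇒maybe (0ℚ ≟ x))

  ℕtoℚ≡mkℚ : ∀ n → ℕtoℚ n ≡ mkℚ (ℤ.+ n) 0 (Coprime.sym (1-coprimeTo n))
  ℕtoℚ≡mkℚ n = normalize-coprime _

  ℕtoℚ-homo-+ : ∀ m n → ℕtoℚ (m ℕ.+ n) ≡ ℕtoℚ m + ℕtoℚ n
  ℕtoℚ-homo-+ m n rewrite ℕtoℚ≡mkℚ m | ℕtoℚ≡mkℚ n =
    cong (_/ 1) (trans (ℤ.pos-+ m n) (sym (cong₂ ℤ._+_ (ℤ.*-identityʳ (ℤ.+ m)) (ℤ.*-identityʳ (ℤ.+ n)))))

  ℕtoℚ-homo-* : ∀ m n → ℕtoℚ (m ℕ.* n) ≡ ℕtoℚ m * ℕtoℚ n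
  ℕtoℚ-homo-* m n rewrite ℕtoℚ≡mkℚ m | ℕtoℚ≡mkℚ n = cong (_/ 1) (ℤ.pos-* m n)

  ℕtoℚ-mono-≤ : ∀ {m n} → m ℕ.≤ n → ℕtoℚ m ≤ ℕtoℚ n
  ℕtoℚ-mono-≤ {m} {n} m≤n rewrite ℕtoℚ≡mkℚ m | ℕtoℚ≡mkℚ n =
    *≤* (ℤ.*-monoʳ-≤-nonNeg (ℤ.+ 1) (ℤ.+≤+ m≤n))

  0≤ℕtoℚ : ∀ n → 0ℚ ≤ ℕtoℚ n
  0≤ℕtoℚ n = ℕtoℚ-mono-≤ {0} {n} ℕ.z≤n

  0≤-+ : ∀ {p q} → 0ℚ ≤ p → 0ℚ ≤ q → 0ℚ ≤ p + q
  0≤-+ = +-mono-≤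

  0≤-* : ∀ {p q} → 0ℚ ≤ p → 0ℚ ≤ q → 0ℚ ≤ p * q
  0≤-* {p} {q} 0≤p 0≤q = nonNegative⁻¹ (p * q)
    {{nonNeg*nonNeg⇒nonNeg p {{nonNegative 0≤p}} q {{nonNegative 0≤q}}}}

  *-monoʳ-≤-0≤ : ∀ {p q r} → 0ℚ ≤ r → p ≤ q → p * r ≤ q * r
  *-monoʳ-≤-0≤ {r = r} 0≤r = *-monoʳ-≤-nonNeg r {{nonNegative 0≤r}}

  *-monoˡ-≤-0≤ : ∀ {p q r} → 0ℚ ≤ r → p ≤ q → r * p ≤ r * q
  *-monoˡ-≤-0≤ {r = r} 0≤r = *-monoˡ-≤-nonNeg r {{nonNegative 0≤r}}

  *-mono-≤-0≤ : ∀ {p q r s} → 0ℚ ≤ p → p ≤ q → 0ℚ ≤ r → r ≤ s → p * r ≤ q * s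
  *-mono-≤-0≤ 0≤p p≤q 0≤r r≤s = ≤-trans (*-monoʳ-≤-0≤ 0≤r p≤q) (*-monoˡ-≤-0≤ (≤-trans 0≤p p≤q) r≤s)

  p≤q⇒0≤q-p : ∀ {p q} → p ≤ q → 0ℚ ≤ q - p
  p≤q⇒0≤q-p {p} {q} p≤q = begin
    0ℚ      ≡⟨ +-inverseʳ p ⟨
    p - p   ≤⟨ +-monoˡ-≤ (- p) p≤q ⟩
    q - p   ∎
    where open ≤-Reasoning

  ≤-via-difference : ∀ {p q} d → q - p ≡ d → 0ℚ ≤ d → p ≤ q
  ≤-via-difference {p} {q} d q-p≡d 0≤d = begin
    p             ≡⟨ +-identityʳ p ⟨
    p + 0ℚ        ≤⟨ +-monoʳ-≤ p 0≤d ⟩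
    p + d         ≡⟨ cong (p +_) q-p≡d ⟨
    p + (q - p)   ≡⟨ p+[q-p]≡q p q ⟩
    q             ∎
    where
    open ≤-Reasoning
    p+[q-p]≡q : ∀ p q → p + (q - p) ≡ q
    p+[q-p]≡q = solve-∀ ℚ-ring

  -1*p≡-p : ∀ p → (- 1ℚ) * p ≡ - p
  -1*p≡-p = solve-∀ ℚ-ring

  horner-+ : ∀ y a b u v → (a + b) + y * (u + v) ≡ (a + y * u) + (b + y * v)
  horner-+ = solve-∀ ℚ-ring

  horner-scale : ∀ y c a u → c * a + y * (c * u) ≡ c * (a + y * u)
  horner-scale = solve-∀ ℚ-ring

  module _ (y : ℚ) where

    eval-⊕ : ∀ p q → eval (p ⊕ q) y ≡ eval p y + eval q y
    eval-⊕ []      q       = sym (+-identityˡ (eval q y))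
    eval-⊕ (a ∷ p) []      = sym (+-identityʳ (eval (a ∷ p) y))
    eval-⊕ (a ∷ p) (b ∷ q) = begin
      (a + b) + y * eval (p ⊕ q) y          ≡⟨ cong (λ e → (a + b) + y * e) (eval-⊕ p q) ⟩
      (a + b) + y * (eval p y + eval q y)   ≡⟨ horner-+ y a b (eval p y) (eval q y) ⟩
      (a + y * eval p y) + (b + y * eval q y) ∎
      where open ≡-Reasoning

    eval-scale : ∀ c p → eval (scale c p) y ≡ c * eval p y
    eval-scale c []      = sym (*-zeroʳ c)
    eval-scale c (a ∷ p) = begin
      c * a + y * eval (scale c p) y   ≡⟨ cong (λ e → c * a + y * e) (eval-scale c p) ⟩
      c * a + y * (c * eval p y)       ≡⟨ horner-scale y c a (eval p y) ⟩
      c * (a + y * eval p y)           ∎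
      where open ≡-Reasoning

    eval-⊗ : ∀ p q → eval (p ⊗ q) y ≡ eval p y * eval q y
    eval-⊗ []      q = sym (*-zeroˡ (eval q y))
    eval-⊗ (a ∷ p) q = begin
      eval (scale a q ⊕ (0ℚ ∷ (p ⊗ q))) y             ≡⟨ eval-⊕ (scale a q) (0ℚ ∷ (p ⊗ q)) ⟩
      eval (scale a q) y + (0ℚ + y * eval (p ⊗ q) y)  ≡⟨ cong₂ (λ u v → u + (0ℚ + y * v)) (eval-scale a q) (eval-⊗ p q) ⟩
      a * eval q y + (0ℚ + y * (eval p y * eval q y)) ≡⟨ factor y a (eval p y) (eval q y) ⟩
      (a + y * eval p y) * eval q y                   ∎
      where
      open ≡-Reasoning
      factor : ∀ y a u v → a * v + (0ℚ + y * (u * v)) ≡ (a + y * u) * v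
      factor = solve-∀ ℚ-ring

    eval-⊖ : ∀ p → eval (⊖ p) y ≡ - eval p y
    eval-⊖ p = trans (eval-scale (- 1ℚ) p) (-1*p≡-p (eval p y))

    eval-derivFrom : ∀ k p → eval (derivFrom k p) y ≡ ℕtoℚ k * eval p y + y * eval (deriv p) y
    eval-derivFrom k []       = regroup y (ℕtoℚ k)
      where
      regroup : ∀ y c → 0ℚ ≡ c * 0ℚ + y * 0ℚ
      regroup = solve-∀ ℚ-ring
    eval-derivFrom k (b ∷ bs) = begin
      ℕtoℚ k * b + y * eval (derivFrom (suc k) bs) y
        ≡⟨ cong (λ e → ℕtoℚ k * b + y * e) (eval-derivFrom (suc k) bs) ⟩
      ℕtoℚ k * b + y * (ℕtoℚ (suc k) * eval bs y + y * eval (deriv bs) y)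
        ≡⟨ cong (λ c → ℕtoℚ k * b + y * (c * eval bs y + y * eval (deriv bs) y)) (ℕtoℚ-homo-+ 1 k) ⟩
      ℕtoℚ k * b + y * ((1ℚ + ℕtoℚ k) * eval bs y + y * eval (deriv bs) y)
        ≡⟨ regroup y (ℕtoℚ k) b (eval bs y) (eval (deriv bs) y) ⟩
      ℕtoℚ k * (b + y * eval bs y) + y * (1ℚ * eval bs y + y * eval (deriv bs) y)
        ≡⟨ cong (λ e → ℕtoℚ k * (b + y * eval bs y) + y * e) (eval-derivFrom 1 bs) ⟨
      ℕtoℚ k * (b + y * eval bs y) + y * eval (derivFrom 1 bs) y ∎
      where
      open ≡-Reasoning
      regroup : ∀ y c b u v → c * b + y * ((1ℚ + c) * u + y * v) ≡ c * (b + y * u) + y * (1ℚ * u + y * v)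
      regroup = solve-∀ ℚ-ring

    eval-deriv-∷ : ∀ a p → eval (deriv (a ∷ p)) y ≡ eval p y + y * eval (deriv p) y
    eval-deriv-∷ a p = trans (eval-derivFrom 1 p) (cong (_+ y * eval (deriv p) y) (*-identityˡ (eval p y)))

    eval-deriv-⊕ : ∀ p q → eval (deriv (p ⊕ q)) y ≡ eval (deriv p) y + eval (deriv q) y
    eval-deriv-⊕ []      q       = sym (+-identityˡ (eval (deriv q) y))
    eval-deriv-⊕ (a ∷ p) []      = sym (+-identityʳ (eval (deriv (a ∷ p)) y))
    eval-deriv-⊕ (a ∷ p) (b ∷ q) = begin
      eval (deriv ((a + b) ∷ (p ⊕ q))) y
        ≡⟨ eval-deriv-∷ (a + b) (p ⊕ q) ⟩
      eval (p ⊕ q) y + y * eval (deriv (p ⊕ q)) y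
        ≡⟨ cong₂ (λ u v → u + y * v) (eval-⊕ p q) (eval-deriv-⊕ p q) ⟩
      (eval p y + eval q y) + y * (eval (deriv p) y + eval (deriv q) y)
        ≡⟨ horner-+ y (eval p y) (eval q y) (eval (deriv p) y) (eval (deriv q) y) ⟩
      (eval p y + y * eval (deriv p) y) + (eval q y + y * eval (deriv q) y)
        ≡⟨ cong₂ _+_ (eval-deriv-∷ a p) (eval-deriv-∷ b q) ⟨
      eval (deriv (a ∷ p)) y + eval (deriv (b ∷ q)) y ∎
      where open ≡-Reasoning

    eval-deriv-scale : ∀ c p → eval (deriv (scale c p)) y ≡ c * eval (deriv p) y
    eval-deriv-scale c []      = sym (*-zeroʳ c)
    eval-deriv-scale c (a ∷ p) = begin
      eval (deriv ((c * a) ∷ scale c p)) y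
        ≡⟨ eval-deriv-∷ (c * a) (scale c p) ⟩
      eval (scale c p) y + y * eval (deriv (scale c p)) y
        ≡⟨ cong₂ (λ u v → u + y * v) (eval-scale c p) (eval-deriv-scale c p) ⟩
      c * eval p y + y * (c * eval (deriv p) y)
        ≡⟨ horner-scale y c (eval p y) (eval (deriv p) y) ⟩
      c * (eval p y + y * eval (deriv p) y)
        ≡⟨ cong (c *_) (eval-deriv-∷ a p) ⟨
      c * eval (deriv (a ∷ p)) y ∎
      where open ≡-Reasoning

    eval-deriv-⊗ : ∀ p q → eval (deriv (p ⊗ q)) y ≡ eval (deriv p) y * eval q y + eval p y * eval (deriv q) y
    eval-deriv-⊗ []      q = zero-sum (eval q y) (eval (deriv q) y)
      where
      zero-sum : ∀ u v → 0ℚ ≡ 0ℚ * u + 0ℚ * v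
      zero-sum = solve-∀ ℚ-ring
    eval-deriv-⊗ (a ∷ p) q = begin
      eval (deriv (scale a q ⊕ (0ℚ ∷ (p ⊗ q)))) y
        ≡⟨ eval-deriv-⊕ (scale a q) (0ℚ ∷ (p ⊗ q)) ⟩
      eval (deriv (scale a q)) y + eval (deriv (0ℚ ∷ (p ⊗ q))) y
        ≡⟨ cong₂ _+_ (eval-deriv-scale a q) (eval-deriv-∷ 0ℚ (p ⊗ q)) ⟩
      a * D q + (eval (p ⊗ q) y + y * eval (deriv (p ⊗ q)) y)
        ≡⟨ cong₂ (λ u v → a * D q + (u + y * v)) (eval-⊗ p q) (eval-deriv-⊗ p q) ⟩
      a * D q + (E p * E q + y * (D p * E q + E p * D q))
        ≡⟨ regroup y a (E p) (E q) (D p) (D q) ⟩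
      (E p + y * D p) * E q + (a + y * E p) * D q
        ≡⟨ cong (λ u → u * E q + E (a ∷ p) * D q) (eval-deriv-∷ a p) ⟨
      D (a ∷ p) * E q + E (a ∷ p) * D q ∎
      where
      open ≡-Reasoning
      E D : Poly → ℚ
      E p = eval p y
      D p = eval (deriv p) y
      regroup : ∀ y a u v u′ v′ → a * v′ + (u * v + y * (u′ * v + u * v′)) ≡ (u + y * u′) * v + (a + y * u) * v′
      regroup = solve-∀ ℚ-ring

    eval-deriv-⊖ : ∀ p → eval (deriv (⊖ p)) y ≡ - eval (deriv p) y
    eval-deriv-⊖ p = trans (eval-deriv-scale (- 1ℚ) p) (-1*p≡-p (eval (deriv p) y))

  quotient′-numerator : Poly → Poly → Poly
  quotient′-numerator N D = proj₁ (rderiv (N , D))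

  -- The numerator of (f/q)″ over q⁴, in the unsimplified form produced by the quotient rule applied twice.
  quotient″-numerator : (f f′ f″ q q′ q″ : ℚ) → ℚ
  quotient″-numerator f f′ f″ q q′ q″ =
    ((f″ * q + f′ * q′) + - (f′ * q′ + f * q″)) * (q * q) + - ((f′ * q + - (f * q′)) * (q′ * q + q * q′))

  eval-quotient′-numerator : ∀ N D y →
    eval (quotient′-numerator N D) y ≡ eval (deriv N) y * eval D y + - (eval N y * eval (deriv D) y)
  eval-quotient′-numerator N D y = begin
    eval ((deriv N ⊗ D) ⊕ (⊖ (N ⊗ deriv D))) y
      ≡⟨ eval-⊕ y (deriv N ⊗ D) (⊖ (N ⊗ deriv D)) ⟩
    eval (deriv N ⊗ D) y + eval (⊖ (N ⊗ deriv D)) y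
      ≡⟨ cong₂ _+_ (eval-⊗ y (deriv N) D) (trans (eval-⊖ y (N ⊗ deriv D)) (cong -_ (eval-⊗ y N (deriv D)))) ⟩
    eval (deriv N) y * eval D y + - (eval N y * eval (deriv D) y) ∎
    where open ≡-Reasoning

  eval-deriv-quotient′-numerator : ∀ N D y →
    eval (deriv (quotient′-numerator N D)) y ≡
      (eval (deriv (deriv N)) y * eval D y + eval (deriv N) y * eval (deriv D) y)
      + - (eval (deriv N) y * eval (deriv D) y + eval N y * eval (deriv (deriv D)) y)
  eval-deriv-quotient′-numerator N D y = begin
    eval (deriv ((deriv N ⊗ D) ⊕ (⊖ (N ⊗ deriv D)))) y
      ≡⟨ eval-deriv-⊕ y (deriv N ⊗ D) (⊖ (N ⊗ deriv D)) ⟩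
    eval (deriv (deriv N ⊗ D)) y + eval (deriv (⊖ (N ⊗ deriv D))) y
      ≡⟨ cong₂ _+_ (eval-deriv-⊗ y (deriv N) D)
                   (trans (eval-deriv-⊖ y (N ⊗ deriv D)) (cong -_ (eval-deriv-⊗ y N (deriv D)))) ⟩
    (eval (deriv (deriv N)) y * eval D y + eval (deriv N) y * eval (deriv D) y)
      + - (eval (deriv N) y * eval (deriv D) y + eval N y * eval (deriv (deriv D)) y) ∎
    where open ≡-Reasoning

  value-rderiv² : ∀ N D y → value (rderiv (rderiv (N , D))) y ≡
    divℚ (quotient″-numerator (eval N y) (eval (deriv N) y) (eval (deriv (deriv N)) y)
                              (eval D y) (eval (deriv D) y) (eval (deriv (deriv D)) y))
         ((eval D y * eval D y) * (eval D y * eval D y))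
  value-rderiv² N D y = cong₂ divℚ numerator denominator
    where
    eval-D² : eval (D ⊗ D) y ≡ eval D y * eval D y
    eval-D² = eval-⊗ y D D
    denominator = trans (eval-⊗ y (D ⊗ D) (D ⊗ D)) (cong₂ _*_ eval-D² eval-D²)
    numerator = trans (eval-quotient′-numerator (quotient′-numerator N D) (D ⊗ D) y)
      (cong₂ (λ u v → u + - v)
        (cong₂ _*_ (eval-deriv-quotient′-numerator N D y) eval-D²)
        (cong₂ _*_ (eval-quotient′-numerator N D y) (eval-deriv-⊗ y D D)))

  coeffSum : Poly → ℚ
  coeffSum = foldr _+_ 0ℚ

  NonNegCoeffs : Poly → Set
  NonNegCoeffs = All (0ℚ ≤_)

  coeffSum-nonNeg : ∀ {p} → NonNegCoeffs p → 0ℚ ≤ coeffSum p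
  coeffSum-nonNeg []          = ≤-refl
  coeffSum-nonNeg (0≤a ∷ 0≤p) = 0≤-+ 0≤a (coeffSum-nonNeg 0≤p)

  derivFrom-nonNeg : ∀ k {p} → NonNegCoeffs p → NonNegCoeffs (derivFrom k p)
  derivFrom-nonNeg k []          = []
  derivFrom-nonNeg k (0≤b ∷ 0≤p) = 0≤-* (0≤ℕtoℚ k) 0≤b ∷ derivFrom-nonNeg (suc k) 0≤p

  deriv-nonNeg : ∀ {p} → NonNegCoeffs p → NonNegCoeffs (deriv p)
  deriv-nonNeg []        = []
  deriv-nonNeg (_ ∷ 0≤p) = derivFrom-nonNeg 1 0≤p

  length-derivFrom : ∀ k p → length (derivFrom k p) ≡ length p
  length-derivFrom k []       = refl
  length-derivFrom k (b ∷ bs) = cong suc (length-derivFrom (suc k) bs)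

  length-deriv-≤ : ∀ p → length (deriv p) ℕ.≤ length p
  length-deriv-≤ []      = ℕ.z≤n
  length-deriv-≤ (a ∷ p) = ℕ.≤-trans (ℕ.≤-reflexive (length-derivFrom 1 p)) (ℕ.n≤1+n (length p))

  coeffSum-derivFrom-≤ : ∀ k p → NonNegCoeffs p →
                         coeffSum (derivFrom (suc k) p) ≤ ℕtoℚ (k ℕ.+ length p) * coeffSum p
  coeffSum-derivFrom-≤ k []       _           = ≤-reflexive (sym (*-zeroʳ (ℕtoℚ (k ℕ.+ 0))))
  coeffSum-derivFrom-≤ k (b ∷ bs) (0≤b ∷ 0≤bs) = begin
    ℕtoℚ (suc k) * b + coeffSum (derivFrom (suc (suc k)) bs)
      ≤⟨ +-mono-≤ (*-monoʳ-≤-0≤ 0≤b (ℕtoℚ-mono-≤ suc-k≤m)) (coeffSum-derivFrom-≤ (suc k) bs 0≤bs) ⟩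
    ℕtoℚ m * b + ℕtoℚ (suc k ℕ.+ length bs) * coeffSum bs
      ≡⟨ cong (λ n → ℕtoℚ m * b + ℕtoℚ n * coeffSum bs) (ℕ.+-suc k (length bs)) ⟨
    ℕtoℚ m * b + ℕtoℚ m * coeffSum bs
      ≡⟨ *-distribˡ-+ (ℕtoℚ m) b (coeffSum bs) ⟨
    ℕtoℚ m * (b + coeffSum bs) ∎
    where
    open ≤-Reasoning
    m = k ℕ.+ suc (length bs)
    suc-k≤m : suc k ℕ.≤ m
    suc-k≤m = ℕ.≤-trans (ℕ.s≤s (ℕ.m≤m+n k (length bs))) (ℕ.≤-reflexive (sym (ℕ.+-suc k (length bs))))

  coeffSum-deriv-≤ : ∀ n p → NonNegCoeffs p → length p ℕ.≤ suc n → coeffSum (deriv p) ≤ ℕtoℚ n * coeffSum p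
  coeffSum-deriv-≤ n []      _           _              = ≤-reflexive (sym (*-zeroʳ (ℕtoℚ n)))
  coeffSum-deriv-≤ n (a ∷ p) (0≤a ∷ 0≤p) (ℕ.s≤s len≤n) = begin
    coeffSum (derivFrom 1 p)      ≤⟨ coeffSum-derivFrom-≤ 0 p 0≤p ⟩
    ℕtoℚ (length p) * coeffSum p  ≤⟨ *-mono-≤-0≤ (0≤ℕtoℚ (length p)) (ℕtoℚ-mono-≤ len≤n)
                                       (coeffSum-nonNeg 0≤p) (a+p≥p 0≤a) ⟩
    ℕtoℚ n * (a + coeffSum p)     ∎
    where
    open ≤-Reasoning
    a+p≥p : 0ℚ ≤ a → coeffSum p ≤ a + coeffSum p
    a+p≥p 0≤a = ≤-trans (≤-reflexive (sym (+-identityˡ (coeffSum p)))) (+-monoˡ-≤ (coeffSum p) 0≤a)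

  coeffSum-ones : ∀ n → coeffSum (replicate n 1ℚ) ≡ ℕtoℚ n
  coeffSum-ones zero    = refl
  coeffSum-ones (suc n) = trans (cong (1ℚ +_) (coeffSum-ones n)) (sym (ℕtoℚ-homo-+ 1 n))

  eval-nonNeg : ∀ {y} → 0ℚ ≤ y → ∀ {p} → NonNegCoeffs p → 0ℚ ≤ eval p y
  eval-nonNeg 0≤y []          = ≤-refl
  eval-nonNeg 0≤y (0≤a ∷ 0≤p) = 0≤-+ 0≤a (0≤-* 0≤y (eval-nonNeg 0≤y 0≤p))

  module _ {y : ℚ} (0≤y : 0ℚ ≤ y) (y≤1 : y ≤ 1ℚ) where

    eval-≤-coeffSum : ∀ {p} → NonNegCoeffs p → eval p y ≤ coeffSum p
    eval-≤-coeffSum []                = ≤-refl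
    eval-≤-coeffSum {a ∷ p} (_ ∷ 0≤p) = +-monoʳ-≤ a (begin
      y * eval p y    ≤⟨ *-monoʳ-≤-0≤ (eval-nonNeg 0≤y 0≤p) y≤1 ⟩
      1ℚ * eval p y   ≡⟨ *-identityˡ (eval p y) ⟩
      eval p y        ≤⟨ eval-≤-coeffSum 0≤p ⟩
      coeffSum p      ∎)
      where open ≤-Reasoning

    eval-deriv-≤ : ∀ n {p} → NonNegCoeffs p → length p ℕ.≤ suc n →
                   eval (deriv p) y ≤ ℕtoℚ n * coeffSum p
    eval-deriv-≤ n {p} 0≤p len≤ = ≤-trans (eval-≤-coeffSum (deriv-nonNeg 0≤p)) (coeffSum-deriv-≤ n p 0≤p len≤)

    eval-deriv²-≤ : ∀ n {p} → NonNegCoeffs p → length p ℕ.≤ suc n →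
                    eval (deriv (deriv p)) y ≤ ℕtoℚ n * (ℕtoℚ n * coeffSum p)
    eval-deriv²-≤ n {p} 0≤p len≤ = begin
      eval (deriv (deriv p)) y      ≤⟨ eval-deriv-≤ n (deriv-nonNeg 0≤p) (ℕ.≤-trans (length-deriv-≤ p) len≤) ⟩
      ℕtoℚ n * coeffSum (deriv p)   ≤⟨ *-monoˡ-≤-0≤ (0≤ℕtoℚ n) (coeffSum-deriv-≤ n p 0≤p len≤) ⟩
      ℕtoℚ n * (ℕtoℚ n * coeffSum p) ∎
      where open ≤-Reasoning

    ones-nonNeg : ∀ n → NonNegCoeffs (replicate n 1ℚ)
    ones-nonNeg n = replicate⁺ n (0≤ℕtoℚ 1)

    eval-ones-≤ : ∀ n → eval (replicate n 1ℚ) y ≤ ℕtoℚ n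
    eval-ones-≤ n = ≤-trans (eval-≤-coeffSum (ones-nonNeg n)) (≤-reflexive (coeffSum-ones n))

    -- Bernoulli's inequality y^k ≥ 1 - k (1 - y), summed over k < n, with the subtractions moved across.
    eval-ones-Bernoulli : ∀ n →
      ℕtoℚ n + ℕtoℚ n + (1ℚ - y) * ℕtoℚ n ≤ (eval (replicate n 1ℚ) y + eval (replicate n 1ℚ) y) + (1ℚ - y) * (ℕtoℚ n * ℕtoℚ n)
    eval-ones-Bernoulli zero    = ≤-refl
    eval-ones-Bernoulli (suc n) = begin
      ℕtoℚ (suc n) + ℕtoℚ (suc n) + (1ℚ - y) * ℕtoℚ (suc n)
        ≡⟨ cong (λ m → m + m + (1ℚ - y) * m) (ℕtoℚ-homo-+ 1 n) ⟩
      (1ℚ + ν) + (1ℚ + ν) + (1ℚ - y) * (1ℚ + ν)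
        ≤⟨ ≤-via-difference _ (step y q ν)
             (0≤-+ (p≤q⇒0≤q-p (eval-ones-Bernoulli n)) (0≤-* (0≤-+ 0≤1-y 0≤1-y) (p≤q⇒0≤q-p (eval-ones-≤ n)))) ⟩
      ((1ℚ + y * q) + (1ℚ + y * q)) + (1ℚ - y) * ((1ℚ + ν) * (1ℚ + ν))
        ≡⟨ cong (λ m → ((1ℚ + y * q) + (1ℚ + y * q)) + (1ℚ - y) * (m * m)) (ℕtoℚ-homo-+ 1 n) ⟨
      ((1ℚ + y * q) + (1ℚ + y * q)) + (1ℚ - y) * (ℕtoℚ (suc n) * ℕtoℚ (suc n)) ∎
      where
      open ≤-Reasoning
      q = eval (replicate n 1ℚ) y
      ν = ℕtoℚ n
      0≤1-y = p≤q⇒0≤q-p y≤1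
      step : ∀ y q ν →
        (((1ℚ + y * q) + (1ℚ + y * q)) + (1ℚ - y) * ((1ℚ + ν) * (1ℚ + ν))) - ((1ℚ + ν) + (1ℚ + ν) + (1ℚ - y) * (1ℚ + ν))
        ≡ (((q + q) + (1ℚ - y) * (ν * ν)) - (ν + ν + (1ℚ - y) * ν)) + ((1ℚ - y) + (1ℚ - y)) * (ν - q)
      step = solve-∀ ℚ-ring

    eval-ones-≥-half : ∀ n → (1ℚ - y) * ℕtoℚ n ≤ 1ℚ → ℕtoℚ n ≤ eval (replicate n 1ℚ) y + eval (replicate n 1ℚ) y
    eval-ones-≥-half n [1-y]n≤1 = ≤-via-difference _ (split y q ν)
      (0≤-+ (0≤-+ (p≤q⇒0≤q-p (eval-ones-Bernoulli n)) (0≤-* (p≤q⇒0≤q-p y≤1) (0≤ℕtoℚ n)))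
            (0≤-* (0≤ℕtoℚ n) (p≤q⇒0≤q-p [1-y]n≤1)))
      where
      q = eval (replicate n 1ℚ) y
      ν = ℕtoℚ n
      split : ∀ y q ν → (q + q) - ν ≡
        (((q + q) + (1ℚ - y) * (ν * ν)) - (ν + ν + (1ℚ - y) * ν)) + (1ℚ - y) * ν + ν * (1ℚ - (1ℚ - y) * ν)
      split = solve-∀ ℚ-ring

  ∣divℚ∣-≤ : ∀ p d K → 0ℚ ≤ d → 0ℚ ≤ K → ∣ p ∣ ≤ K * d → ∣ divℚ p d ∣ ≤ K
  ∣divℚ∣-≤ p d K 0≤d 0≤K ∣p∣≤Kd with d ≟ 0ℚ
  ... | yes _   = 0≤K
  ... | no d≢0 = *-cancelʳ-≤-pos d {{d>0}} (begin
    ∣ p ÷ d ∣ * d         ≡⟨ cong (∣ p ÷ d ∣ *_) (0≤p⇒∣p∣≡p 0≤d) ⟨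
    ∣ p ÷ d ∣ * ∣ d ∣     ≡⟨ ∣p*q∣≡∣p∣*∣q∣ (p ÷ d) d ⟨
    ∣ p ÷ d * d ∣         ≡⟨ cong ∣_∣ p÷d*d≡p ⟩
    ∣ p ∣                 ≤⟨ ∣p∣≤Kd ⟩
    K * d                 ∎)
    where
    open ≤-Reasoning
    instance
      d≠0 : NonZero d
      d≠0 = ≢-nonZero d≢0
    d>0 : Positive d
    d>0 = nonNeg∧nonZero⇒pos d {{nonNegative 0≤d}}
    p÷d*d≡p : p ÷ d * d ≡ p
    p÷d*d≡p = trans (*-assoc p (1/ d) d) (trans (cong (p *_) (*-inverseˡ d)) (*-identityʳ p))

  ∣p-q∣≤p+q : ∀ {p q} → 0ℚ ≤ p → 0ℚ ≤ q → ∣ p - q ∣ ≤ p + q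
  ∣p-q∣≤p+q {p} {q} 0≤p 0≤q =
    ≤-trans (∣p-q∣≤∣p∣+∣q∣ p q) (≤-reflexive (cong₂ _+_ (0≤p⇒∣p∣≡p 0≤p) (0≤p⇒∣p∣≡p 0≤q)))

  ρq³+3ρ²q²+2ρ³q≤30q⁴ : ∀ {ρ q} → 0ℚ ≤ q → 0ℚ ≤ ρ → ρ ≤ q + q →
    ρ * (q * q * q) + ℕtoℚ 3 * ((ρ * ρ) * (q * q)) + ℕtoℚ 2 * ((ρ * ρ * ρ) * q) ≤ ℕtoℚ 30 * ((q * q) * (q * q))
  ρq³+3ρ²q²+2ρ³q≤30q⁴ {ρ} {q} 0≤q 0≤ρ ρ≤2q = ≤-trans
    (+-mono-≤ (+-mono-≤ (*-monoʳ-≤-0≤ 0≤q³ ρ≤2q) (*-monoˡ-≤-0≤ (0≤ℕtoℚ 3) (*-monoʳ-≤-0≤ 0≤q² ρ²≤)))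
              (*-monoˡ-≤-0≤ (0≤ℕtoℚ 2) (*-monoʳ-≤-0≤ 0≤q (*-mono-≤-0≤ (0≤-* 0≤ρ 0≤ρ) ρ²≤ 0≤ρ ρ≤2q))))
    (≤-reflexive (evaluate q))
    where
    0≤q² = 0≤-* 0≤q 0≤q
    0≤q³ = 0≤-* 0≤q² 0≤q
    ρ²≤ = *-mono-≤-0≤ 0≤ρ ρ≤2q 0≤ρ ρ≤2q
    evaluate : ∀ q →
      (q + q) * (q * q * q) + ℕtoℚ 3 * (((q + q) * (q + q)) * (q * q)) + ℕtoℚ 2 * (((q + q) * (q + q) * (q + q)) * q)
      ≡ ℕtoℚ 30 * ((q * q) * (q * q))
    evaluate = solve-∀ ℚ-ring

  quotient″-numerator-bound : ∀ {f f′ f″ q q′ q″ ρ G} →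
    0ℚ ≤ f → f ≤ G → 0ℚ ≤ f′ → f′ ≤ ρ * G → 0ℚ ≤ f″ → f″ ≤ ρ * (ρ * G) →
    0ℚ ≤ q′ → q′ ≤ ρ * ρ → 0ℚ ≤ q″ → q″ ≤ ρ * (ρ * ρ) → 0ℚ ≤ q → 0ℚ ≤ ρ → ρ ≤ q + q →
    ∣ quotient″-numerator f f′ f″ q q′ q″ ∣ ≤ (ρ * G) * (ℕtoℚ 30 * ((q * q) * (q * q)))
  quotient″-numerator-bound {f} {f′} {f″} {q} {q′} {q″} {ρ} {G}
                            0≤f f≤G 0≤f′ f′≤ 0≤f″ f″≤ 0≤q′ q′≤ 0≤q″ q″≤ 0≤q 0≤ρ ρ≤2q = begin
    ∣ quotient″-numerator f f′ f″ q q′ q″ ∣   ≡⟨ cong ∣_∣ (as-difference f f′ f″ q q′ q″) ⟩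
    ∣ P - M ∣                                ≤⟨ ∣p-q∣≤p+q 0≤P 0≤M ⟩
    P + M                                    ≤⟨ +-mono-≤ (+-mono-≤ t₁ t₂) (+-mono-≤ t₃ t₄) ⟩
    _                                        ≡⟨ collect ρ G q ⟩
    (ρ * G) * (ρ * (q * q * q) + ℕtoℚ 3 * ((ρ * ρ) * (q * q)) + ℕtoℚ 2 * ((ρ * ρ * ρ) * q))
      ≤⟨ *-monoˡ-≤-0≤ (0≤-* 0≤ρ (≤-trans 0≤f f≤G)) (ρq³+3ρ²q²+2ρ³q≤30q⁴ 0≤q 0≤ρ ρ≤2q) ⟩
    (ρ * G) * (ℕtoℚ 30 * ((q * q) * (q * q))) ∎
    where
    open ≤-Reasoning
    P = f″ * (q * q * q) + (f * q) * (q′ * q′ + q′ * q′)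
    M = f * q″ * (q * q) + (f′ * (q * q)) * (q′ + q′)
    as-difference : ∀ f f′ f″ q q′ q″ →
      ((f″ * q + f′ * q′) + - (f′ * q′ + f * q″)) * (q * q) + - ((f′ * q + - (f * q′)) * (q′ * q + q * q′))
      ≡ (f″ * (q * q * q) + (f * q) * (q′ * q′ + q′ * q′)) - (f * q″ * (q * q) + (f′ * (q * q)) * (q′ + q′))
    as-difference = solve-∀ ℚ-ring
    collect : ∀ ρ G q →
      ρ * (ρ * G) * (q * q * q) + (G * q) * ((ρ * ρ) * (ρ * ρ) + (ρ * ρ) * (ρ * ρ))
        + (G * (ρ * (ρ * ρ)) * (q * q) + ((ρ * G) * (q * q)) * (ρ * ρ + ρ * ρ))
      ≡ (ρ * G) * (ρ * (q * q * q) + ℕtoℚ 3 * ((ρ * ρ) * (q * q)) + ℕtoℚ 2 * ((ρ * ρ * ρ) * q))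
    collect = solve-∀ ℚ-ring
    0≤q² = 0≤-* 0≤q 0≤q
    0≤q′q′ = 0≤-* 0≤q′ 0≤q′
    0≤P = 0≤-+ (0≤-* 0≤f″ (0≤-* 0≤q² 0≤q)) (0≤-* (0≤-* 0≤f 0≤q) (0≤-+ 0≤q′q′ 0≤q′q′))
    0≤M = 0≤-+ (0≤-* (0≤-* 0≤f 0≤q″) 0≤q²) (0≤-* (0≤-* 0≤f′ 0≤q²) (0≤-+ 0≤q′ 0≤q′))
    q′q′≤ = *-mono-≤-0≤ 0≤q′ q′≤ 0≤q′ q′≤
    t₁ = *-monoʳ-≤-0≤ (0≤-* 0≤q² 0≤q) f″≤
    t₂ = *-mono-≤-0≤ (0≤-* 0≤f 0≤q) (*-monoʳ-≤-0≤ 0≤q f≤G) (0≤-+ 0≤q′q′ 0≤q′q′) (+-mono-≤ q′q′≤ q′q′≤)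
    t₃ = *-monoʳ-≤-0≤ 0≤q² (*-mono-≤-0≤ 0≤f f≤G 0≤q″ q″≤)
    t₄ = *-mono-≤-0≤ (0≤-* 0≤f′ 0≤q²) (*-monoʳ-≤-0≤ 0≤q² f′≤) (0≤-+ 0≤q′ 0≤q′) (+-mono-≤ q′≤ q′≤)

  ∣value-rderiv²∣-≤ : ∀ {y} → 0ℚ ≤ y → y ≤ 1ℚ → ∀ n {F Q} →
    NonNegCoeffs F → length F ℕ.≤ suc n → NonNegCoeffs Q → length Q ℕ.≤ suc n →
    coeffSum Q ≤ ℕtoℚ n → ℕtoℚ n ≤ eval Q y + eval Q y →
    ∣ value (rderiv (rderiv (F , Q))) y ∣ ≤ ℕtoℚ n * coeffSum F * ℕtoℚ 30
  ∣value-rderiv²∣-≤ {y} 0≤y y≤1 n {F} {Q} 0≤F lenF 0≤Q lenQ ∑Q≤n n≤2Q = begin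
    ∣ value (rderiv (rderiv (F , Q))) y ∣  ≡⟨ cong ∣_∣ (value-rderiv² F Q y) ⟩
    ∣ divℚ numerator q⁴ ∣                 ≤⟨ ∣divℚ∣-≤ numerator q⁴ K 0≤q⁴ 0≤K ∣numerator∣≤Kq⁴ ⟩
    K                                     ∎
    where
    open ≤-Reasoning
    q q⁴ K numerator : ℚ
    q = eval Q y
    q⁴ = (q * q) * (q * q)
    K = ℕtoℚ n * coeffSum F * ℕtoℚ 30
    numerator = quotient″-numerator (eval F y) (eval (deriv F) y) (eval (deriv (deriv F)) y)
                                    q (eval (deriv Q) y) (eval (deriv (deriv Q)) y)
    0≤q = eval-nonNeg 0≤y 0≤Q
    0≤q⁴ = 0≤-* (0≤-* 0≤q 0≤q) (0≤-* 0≤q 0≤q)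
    0≤K = 0≤-* (0≤-* (0≤ℕtoℚ n) (coeffSum-nonNeg 0≤F)) (0≤ℕtoℚ 30)
    n*-mono : ∀ {p q} → p ≤ q → ℕtoℚ n * p ≤ ℕtoℚ n * q
    n*-mono = *-monoˡ-≤-0≤ (0≤ℕtoℚ n)
    ∣numerator∣≤ : ∣ numerator ∣ ≤ ℕtoℚ n * coeffSum F * (ℕtoℚ 30 * q⁴)
    ∣numerator∣≤ = quotient″-numerator-bound
      (eval-nonNeg 0≤y 0≤F) (eval-≤-coeffSum 0≤y y≤1 0≤F)
      (eval-nonNeg 0≤y (deriv-nonNeg 0≤F)) (eval-deriv-≤ 0≤y y≤1 n 0≤F lenF)
      (eval-nonNeg 0≤y (deriv-nonNeg (deriv-nonNeg 0≤F))) (eval-deriv²-≤ 0≤y y≤1 n 0≤F lenF)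
      (eval-nonNeg 0≤y (deriv-nonNeg 0≤Q)) (≤-trans (eval-deriv-≤ 0≤y y≤1 n 0≤Q lenQ) (n*-mono ∑Q≤n))
      (eval-nonNeg 0≤y (deriv-nonNeg (deriv-nonNeg 0≤Q)))
      (≤-trans (eval-deriv²-≤ 0≤y y≤1 n 0≤Q lenQ) (n*-mono (n*-mono ∑Q≤n)))
      0≤q (0≤ℕtoℚ n) n≤2Q
    ∣numerator∣≤Kq⁴ : ∣ numerator ∣ ≤ K * q⁴
    ∣numerator∣≤Kq⁴ = ≤-trans ∣numerator∣≤ (≤-reflexive (sym (*-assoc (ℕtoℚ n * coeffSum F) (ℕtoℚ 30) q⁴)))

  coeffSum-map-ℕtoℚ : ∀ (f : ℕ → ℕ) l → coeffSum (map (λ k → ℕtoℚ (f k)) l) ≡ ℕtoℚ (List.sum (map f l))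
  coeffSum-map-ℕtoℚ f []      = refl
  coeffSum-map-ℕtoℚ f (k ∷ l) = trans (cong (ℕtoℚ (f k) +_) (coeffSum-map-ℕtoℚ f l)) (sym (ℕtoℚ-homo-+ (f k) _))

  map-ℕtoℚ-nonNeg : ∀ (f : ℕ → ℕ) l → NonNegCoeffs (map (λ k → ℕtoℚ (f k)) l)
  map-ℕtoℚ-nonNeg f []      = []
  map-ℕtoℚ-nonNeg f (k ∷ l) = 0≤ℕtoℚ (f k) ∷ map-ℕtoℚ-nonNeg f l

  coeffSum-Fpoly-≤ : ∀ A → coeffSum (Fpoly A) ≤ ℕtoℚ (4 ℕ.* (A ℕ.* A))
  coeffSum-Fpoly-≤ A = ≤-trans (≤-reflexive (coeffSum-map-ℕtoℚ (β A) (upTo (suc (r A)))))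
                               (ℕtoℚ-mono-≤ (Combinatorics.sum-β-≤ A))

  ∣fA''∣-≤ : ∀ A {y} → 0ℚ ≤ y → y ≤ 1ℚ → (1ℚ - y) * ℕtoℚ (r A) ≤ 1ℚ →
             ∣ fA'' A y ∣ ≤ ℕtoℚ (120 ℕ.* (A ℕ.* A) ℕ.* r A)
  ∣fA''∣-≤ A {y} 0≤y y≤1 [1-y]r≤1 = begin
    ∣ fA'' A y ∣
      ≤⟨ ∣value-rderiv²∣-≤ 0≤y y≤1 (r A) (map-ℕtoℚ-nonNeg (β A) (upTo (suc (r A)))) lenF
           (ones-nonNeg 0≤y y≤1 (r A)) lenQ (≤-reflexive (coeffSum-ones (r A))) (eval-ones-≥-half 0≤y y≤1 (r A) [1-y]r≤1) ⟩
    ℕtoℚ (r A) * coeffSum (Fpoly A) * ℕtoℚ 30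
      ≤⟨ *-monoʳ-≤-0≤ (0≤ℕtoℚ 30) (*-monoˡ-≤-0≤ (0≤ℕtoℚ (r A)) (coeffSum-Fpoly-≤ A)) ⟩
    ℕtoℚ (r A) * ℕtoℚ (4 ℕ.* (A ℕ.* A)) * ℕtoℚ 30
      ≡⟨ trans (ℕtoℚ-homo-* (r A ℕ.* (4 ℕ.* (A ℕ.* A))) 30) (cong (_* ℕtoℚ 30) (ℕtoℚ-homo-* (r A) (4 ℕ.* (A ℕ.* A)))) ⟨
    ℕtoℚ (r A ℕ.* (4 ℕ.* (A ℕ.* A)) ℕ.* 30)
      ≡⟨ cong ℕtoℚ (rearrange A (r A)) ⟩
    ℕtoℚ (120 ℕ.* (A ℕ.* A) ℕ.* r A) ∎
    where
    open ≤-Reasoning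
    lenF : length (Fpoly A) ℕ.≤ suc (r A)
    lenF = ℕ.≤-reflexive (trans (length-map _ (upTo (suc (r A)))) (length-upTo (suc (r A))))
    lenQ : length (Qpoly A) ℕ.≤ suc (r A)
    lenQ = ℕ.≤-trans (ℕ.≤-reflexive (length-replicate (r A))) (ℕ.n≤1+n (r A))
    rearrange : ∀ a n → n ℕ.* (4 ℕ.* (a ℕ.* a)) ℕ.* 30 ≡ 120 ℕ.* (a ℕ.* a) ℕ.* n
    rearrange = ℕ.solve-∀

  ½^t*2^t≡1 : ∀ t → powℚ ½ t * ℕtoℚ (2 ^ t) ≡ 1ℚ
  ½^t*2^t≡1 zero    = refl
  ½^t*2^t≡1 (suc t) = begin
    ½ * powℚ ½ t * ℕtoℚ (2 ℕ.* 2 ^ t)          ≡⟨ cong (½ * powℚ ½ t *_) (ℕtoℚ-homo-* 2 (2 ^ t)) ⟩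
    ½ * powℚ ½ t * (ℕtoℚ 2 * ℕtoℚ (2 ^ t))     ≡⟨ interchange ½ (ℕtoℚ 2) (powℚ ½ t) (ℕtoℚ (2 ^ t)) ⟩
    (½ * ℕtoℚ 2) * (powℚ ½ t * ℕtoℚ (2 ^ t))   ≡⟨ *-identityˡ _ ⟩
    powℚ ½ t * ℕtoℚ (2 ^ t)                    ≡⟨ ½^t*2^t≡1 t ⟩
    1ℚ                                          ∎
    where
    open ≡-Reasoning
    interchange : ∀ a b c d → a * c * (b * d) ≡ (a * b) * (c * d)
    interchange = solve-∀ ℚ-ring

  0≤½^t : ∀ t → 0ℚ ≤ powℚ ½ t
  0≤½^t zero    = 0≤ℕtoℚ 1
  0≤½^t (suc t) = 0≤-* (nonNegative⁻¹ ½) (0≤½^t t)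

  ½^t≤1 : ∀ t → powℚ ½ t ≤ 1ℚ
  ½^t≤1 t = begin
    powℚ ½ t                 ≡⟨ *-identityʳ (powℚ ½ t) ⟨
    powℚ ½ t * 1ℚ            ≤⟨ *-monoˡ-≤-0≤ (0≤½^t t) (ℕtoℚ-mono-≤ (ℕ.m^n>0 2 t)) ⟩
    powℚ ½ t * ℕtoℚ (2 ^ t)  ≡⟨ ½^t*2^t≡1 t ⟩
    1ℚ                       ∎
    where open ≤-Reasoning

  yt<y⇒0≤y : ∀ t {y} → yt t < y → 0ℚ ≤ y
  yt<y⇒0≤y t yt<y = ≤-trans (p≤q⇒0≤q-p (½^t≤1 t)) (<⇒≤ yt<y)

  yt<y⇒[1-y]n≤1 : ∀ t {y} n → n ℕ.≤ 2 ^ t → yt t < y → (1ℚ - y) * ℕtoℚ n ≤ 1ℚ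
  yt<y⇒[1-y]n≤1 t {y} n n≤2^t yt<y = begin
    (1ℚ - y) * ℕtoℚ n        ≤⟨ *-monoʳ-≤-0≤ (0≤ℕtoℚ n) 1-y≤½^t ⟩
    powℚ ½ t * ℕtoℚ n        ≤⟨ *-monoˡ-≤-0≤ (0≤½^t t) (ℕtoℚ-mono-≤ n≤2^t) ⟩
    powℚ ½ t * ℕtoℚ (2 ^ t)  ≡⟨ ½^t*2^t≡1 t ⟩
    1ℚ                       ∎
    where
    open ≤-Reasoning
    swap : ∀ y h → h - (1ℚ - y) ≡ y - (1ℚ - h)
    swap = solve-∀ ℚ-ring
    1-y≤½^t : 1ℚ - y ≤ powℚ ½ t
    1-y≤½^t = ≤-via-difference _ (swap y (powℚ ½ t)) (p≤q⇒0≤q-p (<⇒≤ yt<y))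

open import Data.Nat using (ℕ; _*_; _^_; _≤_)
open import Data.Rational using (ℚ; 1ℚ; ∣_∣) renaming (_<_ to _<ℚ_; _≤_ to _≤ℚ_)
open import Data.Product using (∃-syntax; _,_)
open import Data.Rational.Properties using (<⇒≤)
open Estimates using (∣fA''∣-≤; yt<y⇒0≤y; yt<y⇒[1-y]n≤1)

lemma5p4 : ∃[ C ] ((A t : ℕ) → 1 ≤ A → 1 ≤ t → r A ≤ 2 ^ t → (y : ℚ) → yt t <ℚ y → y <ℚ 1ℚ → ∣ fA'' A y ∣ ≤ℚ ℕtoℚ (C * (A * A) * r A))
lemma5p4 = 120 , λ A t _ _ r≤2^t y yt<y y<1 →
  ∣fA''∣-≤ A (yt<y⇒0≤y t yt<y) (<⇒≤ y<1) (yt<y⇒[1-y]n≤1 t (r A) r≤2^t yt<y)
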